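{- Let $\mathbf L=(L,\vee,\wedge)$ be a lattice, $a,b\in L$ with $a\leq b$, $x\in[a,b]$, $y\in L$, and put $e:=(a\vee y)\wedge b$ and $f:=a\vee(y\wedge b)$. Then $f\leq e$, and the following are equivalent: (i) $e,f\in R(a,b,x)$; (ii) $(a\vee y)\wedge x=a$ and $x\vee(y\wedge b)=b$.
   Context: For a lattice $\mathbf L$, elements $a\leq b$ and $x\in[a,b]=\{z\in L\mid a\leq z\leq b\}$, an element $z\in[a,b]$ is a relative complement of $x$ in $[a,b]$ if $x\vee z=b$ and $x\wedge z=a$. $R(a,b,x)$ denotes the set of all relative complements of $x$ in $[a,b]$. -}

module Defs where

open import Level using (Level; _⊔_)
open import Data.Product using (_×_)
open import Relation.Binary.Lattice.Bundles using (Lattice)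

module _ {c ℓ₁ ℓ₂ : Level} (L : Lattice c ℓ₁ ℓ₂) where
  open Lattice L

  Interval : Carrier → Carrier → Carrier → Set ℓ₂
  Interval a b z = (a ≤ z) × (z ≤ b)

  R : Carrier → Carrier → Carrier → Carrier → Set (ℓ₁ ⊔ ℓ₂)
  R a b x z = Interval a b z × ((x ∨ z) ≈ b) × ((x ∧ z) ≈ a)

{-# OPTIONS --safe #-}

-- Since a ≤ x ≤ b, the meet x ∧ e collapses to (a ∨ y) ∧ x and the join x ∨ f to
-- x ∨ (y ∧ b), so (ii) says exactly x ∧ e = a and x ∨ f = b. These two equations propagate along
-- f ≤ e to x ∧ f = a and x ∨ e = b, making both e and f relative complements of x.

module Submission where

open import Defs
open import Data.Product using (_×_; _,_; swap)
open import Function.Bundles using (_⇔_; mk⇔)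
open import Relation.Binary.Lattice.Bundles using (Lattice)

module RelativeComplements {c ℓ₁ ℓ₂} (L : Lattice c ℓ₁ ℓ₂) where
  open Lattice L
  open import Relation.Binary.Lattice.Properties.JoinSemilattice joinSemilattice
    using (∨-monotonic)
  open import Relation.Binary.Lattice.Properties.MeetSemilattice meetSemilattice
    using (∧-monotonic)

  modular-inequality : ∀ {a b} y → a ≤ b → a ∨ (y ∧ b) ≤ (a ∨ y) ∧ b
  modular-inequality {a} {b} y a≤b =
    ∨-least (∧-greatest (x≤x∨y a y) a≤b)
            (∧-greatest (trans (x∧y≤x y b) (y≤x∨y a y)) (x∧y≤y y b))

  x≤b⇒x∧[z∧b]≈z∧x : ∀ {x b} z → x ≤ b → x ∧ (z ∧ b) ≈ z ∧ x
  x≤b⇒x∧[z∧b]≈z∧x {x} {b} z x≤b = antisym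
    (∧-greatest (trans (x∧y≤y x (z ∧ b)) (x∧y≤x z b)) (x∧y≤x x (z ∧ b)))
    (∧-greatest (x∧y≤y z x) (∧-greatest (x∧y≤x z x) (trans (x∧y≤y z x) x≤b)))

  a≤x⇒x∨[a∨w]≈x∨w : ∀ {a x} w → a ≤ x → x ∨ (a ∨ w) ≈ x ∨ w
  a≤x⇒x∨[a∨w]≈x∨w {a} {x} w a≤x = antisym
    (∨-least (x≤x∨y x w) (∨-least (trans a≤x (x≤x∨y x w)) (y≤x∨y x w)))
    (∨-least (x≤x∨y x (a ∨ w)) (trans (y≤x∨y a w) (y≤x∨y x (a ∨ w))))

  x∨p≈b⇒x∨q≈b : ∀ {x p q b} → p ≤ q → x ∨ q ≤ b → x ∨ p ≈ b → x ∨ q ≈ b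
  x∨p≈b⇒x∨q≈b {x} p≤q x∨q≤b x∨p≈b = antisym x∨q≤b
    (trans (reflexive (Eq.sym x∨p≈b)) (∨-monotonic (refl {x}) p≤q))

  x∧q≈a⇒x∧p≈a : ∀ {x p q a} → p ≤ q → a ≤ x ∧ p → x ∧ q ≈ a → x ∧ p ≈ a
  x∧q≈a⇒x∧p≈a {x} p≤q a≤x∧p x∧q≈a = antisym
    (trans (∧-monotonic (refl {x}) p≤q) (reflexive x∧q≈a)) a≤x∧p

  nested-relative-complements : ∀ {a b x p q} → Interval L a b x →
    Interval L a b p → Interval L a b q → p ≤ q → x ∨ p ≈ b → x ∧ q ≈ a →
    R L a b x p × R L a b x q
  nested-relative-complements (a≤x , x≤b) p∈[a,b]@(a≤p , _) q∈[a,b]@(_ , q≤b)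
                              p≤q x∨p≈b x∧q≈a =
      (p∈[a,b] , x∨p≈b , x∧q≈a⇒x∧p≈a p≤q (∧-greatest a≤x a≤p) x∧q≈a)
    , (q∈[a,b] , x∨p≈b⇒x∨q≈b p≤q (∨-least x≤b q≤b) x∨p≈b , x∧q≈a)

theorem1 : ∀ {c ℓ₁ ℓ₂} (L : Lattice c ℓ₁ ℓ₂) → let open Lattice L in
    (a b x y : Carrier) → a ≤ b → Interval L a b x →
      (a ∨ (y ∧ b)) ≤ ((a ∨ y) ∧ b)
      × ((R L a b x ((a ∨ y) ∧ b) × R L a b x (a ∨ (y ∧ b)))
         ⇔ ((((a ∨ y) ∧ x) ≈ a) × ((x ∨ (y ∧ b)) ≈ b)))
theorem1 L a b x y a≤b x∈[a,b]@(a≤x , x≤b) = f≤e , mk⇔ to from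
  where
  open Lattice L
  open RelativeComplements L

  e f : Carrier
  e = (a ∨ y) ∧ b
  f = a ∨ (y ∧ b)

  f≤e : f ≤ e
  f≤e = modular-inequality y a≤b

  f∈[a,b] : Interval L a b f
  f∈[a,b] = x≤x∨y a (y ∧ b) , trans f≤e (x∧y≤y (a ∨ y) b)

  e∈[a,b] : Interval L a b e
  e∈[a,b] = trans (x≤x∨y a (y ∧ b)) f≤e , x∧y≤y (a ∨ y) b

  x∧e≈[a∨y]∧x : x ∧ e ≈ (a ∨ y) ∧ x
  x∧e≈[a∨y]∧x = x≤b⇒x∧[z∧b]≈z∧x (a ∨ y) x≤b

  x∨f≈x∨[y∧b] : x ∨ f ≈ x ∨ (y ∧ b)
  x∨f≈x∨[y∧b] = a≤x⇒x∨[a∨w]≈x∨w (y ∧ b) a≤x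

  to : R L a b x e × R L a b x f → ((a ∨ y) ∧ x ≈ a) × (x ∨ (y ∧ b) ≈ b)
  to ((_ , _ , x∧e≈a) , (_ , x∨f≈b , _)) =
    Eq.trans (Eq.sym x∧e≈[a∨y]∧x) x∧e≈a , Eq.trans (Eq.sym x∨f≈x∨[y∧b]) x∨f≈b

  from : ((a ∨ y) ∧ x ≈ a) × (x ∨ (y ∧ b) ≈ b) → R L a b x e × R L a b x f
  from ([a∨y]∧x≈a , x∨[y∧b]≈b) = swap
    (nested-relative-complements x∈[a,b] f∈[a,b] e∈[a,b] f≤e
      (Eq.trans x∨f≈x∨[y∧b] x∨[y∧b]≈b) (Eq.trans x∧e≈[a∨y]∧x [a∨y]∧x≈a))
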